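{- Let $\Gamma$ be a regular hypertope of rank $n$ over $I=\{0,\dots,n-1\}$ satisfying $(B_1)$ and $(B_2)$ for the pair $\{0,1\}$, with automorphism group $G$. Let $C$ be a base chamber and $S=\{\rho_0,\dots,\rho_{n-1}\}$ the standard generators of $G$ with respect to $C$, and let $\mathcal{G}$ be the $\{0,1\}$-truncation of $\Gamma$ seen as a graph. The following are equivalent: (a) $\mathcal{G}$ is bipartite; (b) the halving group $H(G)=\langle\rho_0\rho_1\rho_0,\rho_1,\dots,\rho_{n-1}\rangle$ is a proper subgroup of $G$ of index $2$; (c) if $G=\langle S\mid R\rangle$ is the standard presentation of $G$, every relator $r\in R$ contains an even number of occurrences of $\rho_0$; (d) the map $\varphi:S\to\mathbb{Z}_2$ with $\varphi(\rho_0)=1$ and $\varphi(\rho_i)=0$ for $i\ne0$ extends to a group homomorphism $G\to\mathbb{Z}_2$.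
   Context: A regular hypertope is a thin (every residue of a corank-one flag has exactly two elements), residually connected, flag-transitive incidence geometry. For a chamber $C$, $\rho_i$ is the unique automorphism sending $C$ to its $i$-adjacent chamber (the unique chamber differing from $C$ only in its $i$-element); these are the standard generators. $(B_1)$: $\Gamma[0,1]$ is the geometry of a simple graph (vertices = $0$-elements, edges = $1$-elements, each edge incident to exactly two vertices, two vertices on at most one common edge). $(B_2)$: for a $1$-element $e$ and $x$ of type $\notin\{0,1\}$, $e*x$ iff the set of $0$-elements incident to $e$ is contained in the set of $0$-elements incident to $x$. -}

module Defs where

open import Data.Nat using (ℕ; suc; _≤_)
open import Data.Nat.Divisibility using (_∣_)
open import Data.Fin using (Fin; zero; suc)
open import Data.Fin.Properties using (_≟_)
open import Data.Bool using (Bool; true; false; _xor_)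
open import Data.Maybe using (Maybe; just; nothing; is-just)
import Data.Maybe as Maybe
open import Data.List using (List; []; _∷_; length; filter)
open import Data.Product using (Σ; ∃; _×_; _,_)
open import Data.Sum using (_⊎_)
open import Data.Empty using (⊥)
open import Relation.Nullary using (¬_)
open import Relation.Binary.PropositionalEquality using (_≡_; _≢_)
open import Function.Bundles using (_⇔_)

record IncidenceSystem (n : ℕ) : Set₁ where
  field
    X       : Set
    t       : X → Fin n
    _*_     : X → X → Set
    *-refl  : ∀ x → x * x
    *-sym   : ∀ {x y} → x * y → y * x
    t-surj  : ∀ (i : Fin n) → ∃ λ x → t x ≡ i
    *-type  : ∀ {x y} → x * y → t x ≡ t y → x ≡ y

module _ {n : ℕ} (Γ : IncidenceSystem n) where
  open IncidenceSystem Γ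

  -- A flag: a set of pairwise incident elements; since elements of a flag
  -- have pairwise distinct types, it is encoded as a partial map
  -- type ↦ element.  Its type is { i | f i is defined }.
  record Flag : Set where
    field
      f      : Fin n → Maybe X
      typed  : ∀ i x → f i ≡ just x → t x ≡ i
      pairw  : ∀ i j x y → f i ≡ just x → f j ≡ just y → x * y

  record Chamber : Set where
    field
      c      : Fin n → X
      typed  : ∀ i → t (c i) ≡ i
      pairw  : ∀ i j → c i * c j

  IsGeometry : Set
  IsGeometry = ∀ (F : Flag) → Σ Chamber λ C →
    ∀ i x → Flag.f F i ≡ just x → Chamber.c C i ≡ x

  InResidue : Flag → X → Set
  InResidue F x = (Flag.f F (t x) ≡ nothing) ×
                  (∀ i y → Flag.f F i ≡ just y → x * y)

  CorankAtLeast2 : Flag → Set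
  CorankAtLeast2 F = Σ (Fin n) λ i → Σ (Fin n) λ j →
    (i ≢ j) × (Flag.f F i ≡ nothing) × (Flag.f F j ≡ nothing)

  CorankOne : Flag → Fin n → Set
  CorankOne F i = (Flag.f F i ≡ nothing) ×
                  (∀ j → j ≢ i → is-just (Flag.f F j) ≡ true)

  data PathIn (P : X → Set) : X → X → Set where
    here : ∀ {x} → PathIn P x x
    step : ∀ {x y z} → x * y → P y → PathIn P y z → PathIn P x z

  -- Residually connected: every residue of rank ≥ 2 (including Γ itself,
  -- the residue of the empty flag) has connected incidence graph.
  ResiduallyConnected : Set
  ResiduallyConnected = ∀ (F : Flag) → CorankAtLeast2 F →
    ∀ x y → InResidue F x → InResidue F y → PathIn (InResidue F) x y

  Thin : Set
  Thin = ∀ (F : Flag) i → CorankOne F i →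
    Σ X λ x → Σ X λ y → (x ≢ y) × InResidue F x × InResidue F y ×
      (∀ z → InResidue F z → (z ≡ x) ⊎ (z ≡ y))

  record Aut : Set where
    field
      to      : X → X
      from    : X → X
      to-from : ∀ x → to (from x) ≡ x
      from-to : ∀ x → from (to x) ≡ x
      t-pres  : ∀ x → t (to x) ≡ t x
      *-pres  : ∀ x y → (x * y) ⇔ (to x * to y)

  open Aut

  _≈_ : Aut → Aut → Set
  α ≈ β = ∀ x → to α x ≡ to β x

  FlagTransitive : Set
  FlagTransitive = ∀ (F F' : Flag) →
    (∀ i → is-just (Flag.f F i) ≡ is-just (Flag.f F' i)) →
    Σ Aut λ α → ∀ i → Maybe.map (to α) (Flag.f F i) ≡ Flag.f F' i

  record IsRegularHypertope : Set where
    field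
      geometry   : IsGeometry
      thin       : Thin
      resConn    : ResiduallyConnected
      flagTrans  : FlagTransitive

  idA : Aut
  idA = record
    { to = λ x → x ; from = λ x → x
    ; to-from = λ _ → Relation.Binary.PropositionalEquality.refl
    ; from-to = λ _ → Relation.Binary.PropositionalEquality.refl
    ; t-pres = λ _ → Relation.Binary.PropositionalEquality.refl
    ; *-pres = λ _ _ → Function.Bundles.mk⇔ (λ p → p) (λ p → p) }

  _∘A_ : Aut → Aut → Aut
  α ∘A β = record
    { to = λ x → to α (to β x)
    ; from = λ x → from β (from α x)
    ; to-from = λ x → Relation.Binary.PropositionalEquality.trans
        (Relation.Binary.PropositionalEquality.cong (to α) (to-from β (from α x)))
        (to-from α x)
    ; from-to = λ x → Relation.Binary.PropositionalEquality.trans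
        (Relation.Binary.PropositionalEquality.cong (from β) (from-to α (to β x)))
        (from-to β x)
    ; t-pres = λ x → Relation.Binary.PropositionalEquality.trans
        (t-pres α (to β x)) (t-pres β x)
    ; *-pres = λ x y → Function.Bundles.mk⇔
        (λ p → Function.Bundles.Equivalence.to (*-pres α (to β x) (to β y))
                 (Function.Bundles.Equivalence.to (*-pres β x y) p))
        (λ p → Function.Bundles.Equivalence.from (*-pres β x y)
                 (Function.Bundles.Equivalence.from (*-pres α (to β x) (to β y)) p)) }

  invA : Aut → Aut
  invA α = record
    { to = from α ; from = to α
    ; to-from = from-to α ; from-to = to-from α
    ; t-pres = λ x → Relation.Binary.PropositionalEquality.trans
        (Relation.Binary.PropositionalEquality.sym
          (t-pres α (from α x)))
        (Relation.Binary.PropositionalEquality.cong t (to-from α x))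
    ; *-pres = λ x y → Function.Bundles.mk⇔
        (λ p → Function.Bundles.Equivalence.from (*-pres α (from α x) (from α y))
                 (Relation.Binary.PropositionalEquality.subst₂ _*_
                   (Relation.Binary.PropositionalEquality.sym (to-from α x))
                   (Relation.Binary.PropositionalEquality.sym (to-from α y)) p))
        (λ p → Relation.Binary.PropositionalEquality.subst₂ _*_
                 (to-from α x) (to-from α y)
                 (Function.Bundles.Equivalence.to (*-pres α (from α x) (from α y)) p)) }

  -- ρ is the automorphism sending the chamber C to its i-adjacent chamber:
  -- it fixes every element of C except the i-element, which it moves.
  IsStdGen : Chamber → Fin n → Aut → Set
  IsStdGen C i ρ = (∀ j → j ≢ i → to ρ (Chamber.c C j) ≡ Chamber.c C j) ×
                   (to ρ (Chamber.c C i) ≢ Chamber.c C i)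

  data Generated (Gen : Aut → Set) : Aut → Set where
    gen  : ∀ {g} → Gen g → Generated Gen g
    unit : Generated Gen idA
    comp : ∀ {g h} → Generated Gen g → Generated Gen h → Generated Gen (g ∘A h)
    inv  : ∀ {g} → Generated Gen g → Generated Gen (invA g)
    resp : ∀ {g h} → g ≈ h → Generated Gen g → Generated Gen h

  -- A subgroup H (given as a predicate) has index 2 in Aut(Γ):
  -- exactly two left cosets, H and gH for some g ∉ H.
  HasIndex2 : (Aut → Set) → Set
  HasIndex2 H = Σ Aut λ g → ¬ H g × (∀ x → H x ⊎ H (invA g ∘A x))

  evalWord : (Fin n → Aut) → List (Fin n) → Aut
  evalWord ρ []       = idA
  evalWord ρ (i ∷ w)  = ρ i ∘A evalWord ρ w

  -- Relators of the standard presentation ⟨S | R⟩ of G w.r.t. S: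
  -- words in S that are trivial in G.
  IsRelator : (Fin n → Aut) → List (Fin n) → Set
  IsRelator ρ w = evalWord ρ w ≈ idA

  -- Group homomorphisms G → ℤ₂, with ℤ₂ = (Bool, xor).
  record HomToZ2 : Set where
    field
      φ      : Aut → Bool
      φ-resp : ∀ {g h} → g ≈ h → φ g ≡ φ h
      φ-hom  : ∀ g h → φ (g ∘A h) ≡ φ g xor φ h

count0 : ∀ {n} → List (Fin (suc n)) → ℕ
count0 w = length (filter (_≟ zero) w)

-- Everything below is for rank n = 2 + m, so that types 0 and 1 exist.
module _ {m : ℕ} (Γ : IncidenceSystem (suc (suc m))) where
  open IncidenceSystem Γ

  one : Fin (suc (suc m))
  one = suc zero

  -- (B₁): Γ[0,1] is the geometry of a simple graph.
  B1 : Set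
  B1 = (∀ e → t e ≡ one →
          Σ X λ u → Σ X λ v → (u ≢ v) × (t u ≡ zero) × (t v ≡ zero) ×
            (u * e) × (v * e) ×
            (∀ w → t w ≡ zero → w * e → (w ≡ u) ⊎ (w ≡ v)))
     × (∀ u v e e' → t u ≡ zero → t v ≡ zero → u ≢ v →
          t e ≡ one → t e' ≡ one →
          u * e → v * e → u * e' → v * e' → e ≡ e')

  B2 : Set
  B2 = ∀ e x → t e ≡ one → t x ≢ zero → t x ≢ one →
         (e * x) ⇔ (∀ u → t u ≡ zero → u * e → u * x)

  Adjacent : X → X → Set
  Adjacent u v = (t u ≡ zero) × (t v ≡ zero) × (u ≢ v) ×
                 Σ X λ e → (t e ≡ one) × (u * e) × (v * e)

  Bipartite𝒢 : Set
  Bipartite𝒢 = Σ (X → Bool) λ col → ∀ u v → Adjacent u v → col u ≢ col v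

  HalvingGens : (Fin (suc (suc m)) → Aut Γ) → Aut Γ → Set
  HalvingGens ρ h = _≈_ Γ h (_∘A_ Γ (ρ zero) (_∘A_ Γ (ρ one) (ρ zero)))
                  ⊎ (Σ (Fin (suc (suc m))) λ i → (i ≢ zero) × _≈_ Γ h (ρ i))

  HalvingGroup : (Fin (suc (suc m)) → Aut Γ) → Aut Γ → Set
  HalvingGroup ρ = Generated Γ (HalvingGens ρ)

-- Galleries from the base chamber C₀ spelling a word w end at (E w) C₀, and in a thin,
-- residually connected geometry any two chambers of a residue are joined by a gallery
-- inside it; hence the ρᵢ generate G, are involutions, and an automorphism is determined
-- by its action on C₀. A proper 2-colouring c of 𝒢 yields the homomorphism
-- g ↦ c(g v₀) + c(v₀), which does not depend on the base vertex because 0-adjacent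
-- chambers have adjacent vertices. Conversely a homomorphism φ with φ ρ₀ = 1, φ ρᵢ = 0
-- colours the vertex g v₀ by φ g: this is well defined because the stabiliser of v₀ is
-- generated by the ρᵢ with i ≠ 0, and proper because by (B1) adjacent vertices have the
-- form g v₀ and g ρ₀ v₀. Such a φ exists iff every relator contains ρ₀ an even number of times,
-- the parity of a representing word then being well defined on G. Finally (B1) and (B2)
-- make ρ₀ commute with ρᵢ for i ≥ 2, so H(G) contains the even words and ρ₀ H(G) the odd
-- ones: H(G) has index 2 unless ρ₀ ∈ H(G), which happens iff some relator is odd.
module Submission where

open import Defs
open import Data.Bool using (Bool; true; false; not; _xor_)
open import Data.Bool.Properties
  using ( not-involutive; not-injective; not-distribˡ-xor; not-¬; ¬-not
        ; xor-same; xor-assoc; xor-comm; xor-annihilates-not; xor-identityʳ; xor-inverseˡ)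
open import Data.Empty using (⊥-elim)
open import Data.Fin using (Fin; zero; suc)
open import Data.Fin.Properties using (_≟_; any?; suc-injective)
open import Data.List using (List; []; _∷_; _++_; length; filter; reverse)
open import Data.List.Properties using (filter-++; length-++; unfold-reverse; filter-none)
open import Data.List.Relation.Unary.All using (All; []; _∷_)
open import Data.Maybe using (Maybe; just; nothing; is-just)
open import Data.Nat using (ℕ; zero; suc; _+_; _≤_; s≤s⁻¹)
import Data.Nat as ℕ
open import Data.Nat.Properties using (≤-refl; +-comm; +-suc)
open import Data.Nat.Divisibility using (_∣_; divides)
open import Data.Product using (Σ; ∃; _×_; _,_; proj₁; proj₂)
open import Data.Sum using (_⊎_; inj₁; inj₂)
open import Function using (_∘_; case_of_)
open import Function.Bundles using (_⇔_; mk⇔; Equivalence)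
open import Relation.Nullary using (¬_; Dec; yes; no)
open import Relation.Nullary.Decidable using (_×-dec_; ¬?)
open import Relation.Binary.PropositionalEquality
  using (_≡_; _≢_; refl; sym; trans; cong; cong₂; subst; module ≡-Reasoning)

odd : ℕ → Bool
odd zero    = false
odd (suc n) = not (odd n)

odd-+ : ∀ m n → odd (m + n) ≡ odd m xor odd n
odd-+ zero    n = refl
odd-+ (suc m) n = trans (cong not (odd-+ m n)) (not-distribˡ-xor (odd m) (odd n))

even⇒2∣ : ∀ n → odd n ≡ false → 2 ∣ n
even⇒2∣ zero          _    = divides 0 refl
even⇒2∣ (suc (suc n)) even with even⇒2∣ n (trans (sym (not-involutive (odd n))) even)
... | divides q n≡q*2 = divides (suc q) (cong (λ k → suc (suc k)) n≡q*2)

2∣⇒even : ∀ n → 2 ∣ n → odd n ≡ false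
2∣⇒even _ (divides q refl) = odd-double q
  where
  odd-double : ∀ q → odd (q ℕ.* 2) ≡ false
  odd-double zero    = refl
  odd-double (suc q) = trans (not-involutive (odd (q ℕ.* 2))) (odd-double q)

xor≡false⇒≡ : ∀ {a b} → a xor b ≡ false → a ≡ b
xor≡false⇒≡ {false} refl = refl
xor≡false⇒≡ {true}  {true} refl = refl

xor-telescope : ∀ a b c → a xor c ≡ (a xor b) xor (b xor c)
xor-telescope a b c = sym (begin
  (a xor b) xor (b xor c)  ≡⟨ xor-assoc a b (b xor c) ⟩
  a xor (b xor (b xor c))  ≡⟨ cong (a xor_) (xor-assoc b b c) ⟨
  a xor ((b xor b) xor c)  ≡⟨ cong (λ z → a xor (z xor c)) (xor-same b) ⟩
  a xor c                  ∎)
  where open ≡-Reasoning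

xor-≢ : ∀ {a b a′ b′} → a ≢ b → a′ ≢ b′ → a′ xor a ≡ b′ xor b
xor-≢ {b = b} {b′ = b′} a≢b a′≢b′ =
  trans (cong₂ _xor_ (¬-not a′≢b′) (¬-not a≢b)) (xor-annihilates-not b′ b)

module _ {n : ℕ} where

  count0-++ : (u v : List (Fin (suc n))) → count0 (u ++ v) ≡ count0 u + count0 v
  count0-++ u v = trans (cong length (filter-++ (_≟ zero) u v)) (length-++ (filter (_≟ zero) u))

  count0-reverse : (w : List (Fin (suc n))) → count0 (reverse w) ≡ count0 w
  count0-reverse []      = refl
  count0-reverse (i ∷ w) = begin
    count0 (reverse (i ∷ w))               ≡⟨ cong count0 (unfold-reverse i w) ⟩
    count0 (reverse w ++ i ∷ [])           ≡⟨ count0-++ (reverse w) (i ∷ []) ⟩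
    count0 (reverse w) + count0 (i ∷ [])   ≡⟨ cong (_+ count0 (i ∷ [])) (count0-reverse w) ⟩
    count0 w + count0 (i ∷ [])             ≡⟨ +-comm (count0 w) _ ⟩
    count0 (i ∷ []) + count0 w             ≡⟨ count0-++ (i ∷ []) w ⟨
    count0 (i ∷ w)                         ∎
    where open ≡-Reasoning

  count0-avoiding : {w : List (Fin (suc n))} → All (_≢ zero) w → count0 w ≡ 0
  count0-avoiding avoids = cong length (filter-none (_≟ zero) avoids)

module _ {A : Set} {p q : A} where

  other-unique : ∀ {a b c} → a ≡ p ⊎ a ≡ q → b ≡ p ⊎ b ≡ q → c ≡ p ⊎ c ≡ q →
                 a ≢ b → a ≢ c → b ≡ c
  other-unique (inj₁ refl) (inj₁ refl) _           a≢b _   = ⊥-elim (a≢b refl)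
  other-unique (inj₁ refl) (inj₂ refl) (inj₁ refl) _   a≢c = ⊥-elim (a≢c refl)
  other-unique (inj₁ refl) (inj₂ refl) (inj₂ refl) _   _   = refl
  other-unique (inj₂ refl) (inj₂ refl) _           a≢b _   = ⊥-elim (a≢b refl)
  other-unique (inj₂ refl) (inj₁ refl) (inj₂ refl) _   a≢c = ⊥-elim (a≢c refl)
  other-unique (inj₂ refl) (inj₁ refl) (inj₁ refl) _   _   = refl

  ≡-or-≢ : p ≢ q → ∀ {a b} → a ≡ p ⊎ a ≡ q → b ≡ p ⊎ b ≡ q → a ≡ b ⊎ a ≢ b
  ≡-or-≢ _   (inj₁ refl) (inj₁ refl) = inj₁ refl
  ≡-or-≢ _   (inj₂ refl) (inj₂ refl) = inj₁ refl
  ≡-or-≢ p≢q (inj₁ refl) (inj₂ refl) = inj₂ p≢q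
  ≡-or-≢ p≢q (inj₂ refl) (inj₁ refl) = inj₂ (p≢q ∘ sym)

module _ {A : Set} where

  missing : Maybe A → ℕ
  missing nothing  = 1
  missing (just _) = 0

  nothings : ∀ {k} → (Fin k → Maybe A) → ℕ
  nothings {zero}  f = 0
  nothings {suc k} f = missing (f zero) + nothings (f ∘ suc)

  nothings-cong : ∀ {k} {f g : Fin k → Maybe A} → (∀ j → f j ≡ g j) → nothings f ≡ nothings g
  nothings-cong {zero}  f≗g = refl
  nothings-cong {suc k} f≗g = cong₂ _+_ (cong missing (f≗g zero)) (nothings-cong (f≗g ∘ suc))

  nothings-fill : ∀ {k} (f g : Fin k → Maybe A) j {a} → f j ≡ nothing → g j ≡ just a →
                  (∀ l → l ≢ j → f l ≡ g l) → nothings f ≡ suc (nothings g)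
  nothings-fill {suc k} f g zero fj gj f≗g rewrite fj | gj =
    cong suc (nothings-cong (λ l → f≗g (suc l) (λ ())))
  nothings-fill {suc k} f g (suc j) fj gj f≗g =
    trans (cong₂ _+_ (cong missing (f≗g zero (λ ())))
                     (nothings-fill (f ∘ suc) (g ∘ suc) j fj gj
                       (λ l l≢j → f≗g (suc l) (l≢j ∘ suc-injective))))
          (+-suc (missing (g zero)) _)

module ChamberSystem {n : ℕ} (Γ : IncidenceSystem n) where
  open IncidenceSystem Γ
  open Chamber renaming (c to _at_)

  G : Set
  G = Aut Γ

  infixr 9 _·_
  _·_ : G → G → G
  _·_ = _∘A_ Γ

  infix 4 _≋_
  _≋_ : G → G → Set
  _≋_ = _≈_ Γ

  infixr 8 _⊳_
  _⊳_ : G → X → X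
  _⊳_ = Aut.to

  ⊳-injective : ∀ α {x y} → α ⊳ x ≡ α ⊳ y → x ≡ y
  ⊳-injective α {x} {y} αx≡αy =
    trans (sym (Aut.from-to α x)) (trans (cong (Aut.from α) αx≡αy) (Aut.from-to α y))

  ⊳-type : ∀ α x → t (α ⊳ x) ≡ t x
  ⊳-type = Aut.t-pres

  ⊳-* : ∀ α {x y} → x * y → (α ⊳ x) * (α ⊳ y)
  ⊳-* α {x} {y} = Equivalence.to (Aut.*-pres α x y)

  infix 4 _≗ᶜ_ _∼[_]_
  _≗ᶜ_ : Chamber Γ → Chamber Γ → Set
  C ≗ᶜ D = ∀ i → C at i ≡ D at i

  record _∼[_]_ (C : Chamber Γ) (i : Fin n) (D : Chamber Γ) : Set where
    constructor adjacent
    field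
      agree  : ∀ j → j ≢ i → C at j ≡ D at j
      differ : C at i ≢ D at i

  ∼-sym : ∀ {C D i} → C ∼[ i ] D → D ∼[ i ] C
  ∼-sym (adjacent agree differ) = adjacent (λ j j≢i → sym (agree j j≢i)) (differ ∘ sym)

  ∼-respˡ : ∀ {C C′ D i} → C ≗ᶜ C′ → C ∼[ i ] D → C′ ∼[ i ] D
  ∼-respˡ C≗C′ (adjacent agree differ) =
    adjacent (λ j j≢i → trans (sym (C≗C′ j)) (agree j j≢i)) (λ eq → differ (trans (C≗C′ _) eq))

  image : G → Chamber Γ → Chamber Γ
  image α C = record
    { c     = λ i → α ⊳ C at i
    ; typed = λ i → trans (⊳-type α (C at i)) (typed C i)
    ; pairw = λ i j → ⊳-* α (pairw C i j)
    }

  image-∼ : ∀ α {C D i} → C ∼[ i ] D → image α C ∼[ i ] image α D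
  image-∼ α (adjacent agree differ) =
    adjacent (λ j j≢i → cong (α ⊳_) (agree j j≢i)) (differ ∘ ⊳-injective α)

  data Gallery (P : Chamber Γ → Set) : Chamber Γ → Chamber Γ → List (Fin n) → Set where
    stop : ∀ {C D} → C ≗ᶜ D → Gallery P C D []
    step : ∀ {C D E i w} → C ∼[ i ] D → P D → Gallery P D E w → Gallery P C E (i ∷ w)

  gallery-startˡ : ∀ {P C C′ D w} → C ≗ᶜ C′ → Gallery P C′ D w → Gallery P C D w
  gallery-startˡ C≗C′ (stop C′≗D)       = stop (λ i → trans (C≗C′ i) (C′≗D i))
  gallery-startˡ C≗C′ (step C′∼ PD rest) = step (∼-respˡ (λ i → sym (C≗C′ i)) C′∼) PD rest

  gallery-++ : ∀ {P C D E u v} → Gallery P C D u → Gallery P D E v → Gallery P C E (u ++ v)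
  gallery-++ (stop C≗D)        γ = gallery-startˡ C≗D γ
  gallery-++ (step C∼ PD rest) γ = step C∼ PD (gallery-++ rest γ)

  gallery-map : ∀ {P Q : Chamber Γ → Set} → (∀ {C} → P C → Q C) →
                ∀ {C D w} → Gallery P C D w → Gallery Q C D w
  gallery-map P⇒Q (stop C≗D)        = stop C≗D
  gallery-map P⇒Q (step C∼ PD rest) = step C∼ (P⇒Q PD) (gallery-map P⇒Q rest)

  record Contains (F : Flag Γ) (C : Chamber Γ) : Set where
    constructor contains
    field
      agrees : ∀ i x → Flag.f F i ≡ just x → C at i ≡ x
  open Contains public

  Free : Flag Γ → Fin n → Set
  Free F i = Flag.f F i ≡ nothing

  InRes : Flag Γ → X → Set
  InRes = InResidue Γ

  ∅ : Flag Γ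
  ∅ = record { f = λ _ → nothing ; typed = λ _ _ () ; pairw = λ _ _ _ _ () }

  in-res-∅ : ∀ x → InRes ∅ x
  in-res-∅ x = refl , λ _ _ ()

  put : X → (Fin n → Maybe X) → Fin n → Maybe X
  put x f j with j ≟ t x
  ... | yes _ = just x
  ... | no  _ = f j

  put-here : ∀ x f → put x f (t x) ≡ just x
  put-here x f with t x ≟ t x
  ... | yes _    = refl
  ... | no  t≢t  = ⊥-elim (t≢t refl)

  put-elsewhere : ∀ x f j → j ≢ t x → put x f j ≡ f j
  put-elsewhere x f j j≢tx with j ≟ t x
  ... | yes j≡tx = ⊥-elim (j≢tx j≡tx)
  ... | no  _    = refl

  extend : (F : Flag Γ) (x : X) → InRes F x → Flag Γ
  extend F x (_ , x*F) = record { f = put x (Flag.f F) ; typed = typed′ ; pairw = pairw′ }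
    where
    typed′ : ∀ i y → put x (Flag.f F) i ≡ just y → t y ≡ i
    typed′ i y eq with i ≟ t x
    typed′ i y refl | yes i≡tx = sym i≡tx
    typed′ i y eq   | no  _    = Flag.typed F i y eq

    pairw′ : ∀ i j y z → put x (Flag.f F) i ≡ just y → put x (Flag.f F) j ≡ just z → y * z
    pairw′ i j y z eqi eqj with i ≟ t x | j ≟ t x
    pairw′ i j y z refl refl | yes _ | yes _ = *-refl x
    pairw′ i j y z refl eqj  | yes _ | no  _ = x*F j z eqj
    pairw′ i j y z eqi  refl | no  _ | yes _ = *-sym (x*F i y eqi)
    pairw′ i j y z eqi  eqj  | no  _ | no  _ = Flag.pairw F i j y z eqi eqj

  single : X → Flag Γ
  single x = extend ∅ x (in-res-∅ x)

  extend-at : ∀ F x r → Flag.f (extend F x r) (t x) ≡ just x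
  extend-at F x r = put-here x (Flag.f F)

  single-at : ∀ x → Flag.f (single x) (t x) ≡ just x
  single-at x = extend-at ∅ x (in-res-∅ x)

  contains-extend : ∀ {F x C} r → Contains F C → C at t x ≡ x → Contains (extend F x r) C
  contains-extend {F} {x} {C} r C∋F Cx≡x = contains C∋F+x
    where
    C∋F+x : ∀ j y → put x (Flag.f F) j ≡ just y → C at j ≡ y
    C∋F+x j y eq with j ≟ t x
    C∋F+x j y refl | yes refl = Cx≡x
    ... | no _ = agrees C∋F j y eq

  contains-single : ∀ {x C} → C at t x ≡ x → Contains (single x) C
  contains-single {x} = contains-extend (in-res-∅ x) (contains λ _ _ ())

  contains-extend⁻ : ∀ {F x C} r → Contains (extend F x r) C → Contains F C
  contains-extend⁻ {F} {x} {C} (x-free , _) C∋F+x = contains C∋F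
    where
    C∋F : ∀ j y → Flag.f F j ≡ just y → C at j ≡ y
    C∋F j y eq with j ≟ t x
    ... | yes refl = case (trans (sym eq) x-free) of λ ()
    ... | no j≢tx  = agrees C∋F+x j y (trans (put-elsewhere x (Flag.f F) j j≢tx) eq)

  corank : Flag Γ → ℕ
  corank F = nothings (Flag.f F)

  corank-extend : ∀ {F x} r → corank F ≡ suc (corank (extend F x r))
  corank-extend {F} {x} r@(x-free , _) =
    nothings-fill (Flag.f F) (put x (Flag.f F)) (t x) x-free (put-here x (Flag.f F))
                  (λ l l≢tx → sym (put-elsewhere x (Flag.f F) l l≢tx))

  corank-extend-≤ : ∀ {F x k} r → corank F ≤ suc k → corank (extend F x r) ≤ k
  corank-extend-≤ {F} {x} {k} r F≤1+k = s≤s⁻¹ (subst (_≤ suc k) (corank-extend {F} {x} r) F≤1+k)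

  corank-≢0 : ∀ {F x} → InRes F x → ¬ corank F ≤ 0
  corank-≢0 {F} {x} r F≤0 with corank F | corank-extend {F} {x} r
  corank-≢0 r () | _ | refl

  free? : ∀ F i → Dec (Free F i)
  free? F i with Flag.f F i
  ... | nothing = yes refl
  ... | just _  = no λ ()

  ¬free⇒is-just : ∀ F i → ¬ Free F i → is-just (Flag.f F i) ≡ true
  ¬free⇒is-just F i ¬free with Flag.f F i
  ... | nothing = ⊥-elim (¬free refl)
  ... | just _  = refl

  contains-agree : ∀ {F C D} → Contains F C → Contains F D → ∀ j → is-just (Flag.f F j) ≡ true →
               C at j ≡ D at j
  contains-agree {F} C∋F D∋F j defined with Flag.f F j in eq
  ... | just x = trans (agrees C∋F j x eq) (sym (agrees D∋F j x eq))

  in-res-chamber : ∀ {F C} → Contains F C → ∀ i → Free F i → InRes F (C at i)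
  in-res-chamber {F} {C} C∋F i Fi =
    subst (Free F) (sym (typed C i)) Fi ,
    λ l y eq → subst (λ z → (C at i) * z) (agrees C∋F l y eq) (pairw C i l)

  in-res-extend : ∀ {F x z} r → InRes F z → t z ≢ t x → x * z → InRes (extend F x r) z
  in-res-extend {F} {x} {z} r (z-free , z*F) tz≢tx x*z =
    trans (put-elsewhere x (Flag.f F) (t z) tz≢tx) z-free , z*F+x
    where
    z*F+x : ∀ l y → put x (Flag.f F) l ≡ just y → z * y
    z*F+x l y eq with l ≟ t x
    z*F+x l y refl | yes _ = *-sym x*z
    z*F+x l y eq   | no  _ = z*F l y eq

  remove : Fin n → (Fin n → X) → Fin n → Maybe X
  remove i c j with j ≟ i
  ... | yes _ = nothing
  ... | no  _ = just (c j)

  panel : Chamber Γ → Fin n → Flag Γ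
  panel C i = record { f = remove i (C at_) ; typed = typed′ ; pairw = pairw′ }
    where
    typed′ : ∀ j y → remove i (C at_) j ≡ just y → t y ≡ j
    typed′ j y eq with j ≟ i
    typed′ j y () | yes _
    typed′ j y refl | no _ = typed C j

    pairw′ : ∀ j k y z → remove i (C at_) j ≡ just y → remove i (C at_) k ≡ just z → y * z
    pairw′ j k y z eqj eqk with j ≟ i | k ≟ i
    pairw′ j k y z ()   _    | yes _ | _
    pairw′ j k y z _    ()   | no  _ | yes _
    pairw′ j k y z refl refl | no  _ | no  _ = pairw C j k

  panel-corank-one : ∀ C i → CorankOne Γ (panel C i) i
  panel-corank-one C i = i-free , others-defined
    where
    i-free : remove i (C at_) i ≡ nothing
    i-free with i ≟ i
    ... | yes _   = refl
    ... | no  i≢i = ⊥-elim (i≢i refl)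

    others-defined : ∀ j → j ≢ i → is-just (remove i (C at_) j) ≡ true
    others-defined j j≢i with j ≟ i
    ... | yes j≡i = ⊥-elim (j≢i j≡i)
    ... | no  _   = refl

  contains-panel : ∀ C i {D} → (∀ j → j ≢ i → C at j ≡ D at j) → Contains (panel C i) D
  contains-panel C i {D} agree = contains D∋panel
    where
    D∋panel : ∀ j y → remove i (C at_) j ≡ just y → D at j ≡ y
    D∋panel j y eq with j ≟ i
    D∋panel j y ()   | yes _
    D∋panel j y refl | no j≢i = sym (agree j j≢i)

  in-res-panel : ∀ C i {y} → t y ≡ i → (∀ l → l ≢ i → y * (C at l)) → InRes (panel C i) y
  in-res-panel C i {y} ty≡i y*C =
    subst (Free (panel C i)) (sym ty≡i) (proj₁ (panel-corank-one C i)) , y*panel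
    where
    y*panel : ∀ l z → remove i (C at_) l ≡ just z → y * z
    y*panel l z eq with l ≟ i
    y*panel l z ()   | yes _
    y*panel l z refl | no l≢i = y*C l l≢i

  gallery-avoids : ∀ {F C D w i x} → Flag.f F i ≡ just x → Contains F C →
                   Gallery (Contains F) C D w → All (_≢ i) w
  gallery-avoids Fi C∋F (stop _)                             = []
  gallery-avoids Fi C∋F (step (adjacent _ differ) D∋F rest) =
    (λ { refl → differ (trans (agrees C∋F _ _ Fi) (sym (agrees D∋F _ _ Fi))) }) ∷
    gallery-avoids Fi D∋F rest

module Thinness {n : ℕ} (Γ : IncidenceSystem n) (thin : Thin Γ) where
  open IncidenceSystem Γ
  open Chamber renaming (c to _at_)
  open ChamberSystem Γ

  residue-other-unique : ∀ F i → CorankOne Γ F i → ∀ {a b c} →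
                         InRes F a → InRes F b → InRes F c → a ≢ b → a ≢ c → b ≡ c
  residue-other-unique F i co ra rb rc with thin F i co
  ... | _ , _ , _ , _ , _ , two = other-unique (two _ ra) (two _ rb) (two _ rc)

  residue-≡-or-≢ : ∀ F i → CorankOne Γ F i → ∀ {a b} → InRes F a → InRes F b → a ≡ b ⊎ a ≢ b
  residue-≡-or-≢ F i co ra rb with thin F i co
  ... | _ , _ , p≢q , _ , _ , two = ≡-or-≢ p≢q (two _ ra) (two _ rb)

  adjacent-unique : ∀ {C D D′ i} → C ∼[ i ] D → C ∼[ i ] D′ → D ≗ᶜ D′
  adjacent-unique {C} {D} {D′} {i} (adjacent agree differ) (adjacent agree′ differ′) j with j ≟ i
  ... | no  j≢i  = trans (sym (agree j j≢i)) (agree′ j j≢i)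
  ... | yes refl =
    residue-other-unique (panel C i) i (panel-corank-one C i)
      (in-res-chamber (contains-panel C i {C} (λ _ _ → refl)) i i-free)
      (in-res-chamber (contains-panel C i {D} agree) i i-free)
      (in-res-chamber (contains-panel C i {D′} agree′) i i-free)
      differ differ′
    where
    i-free = proj₁ (panel-corank-one C i)

  corank-one-≗-or-∼ : ∀ {F i C D} → CorankOne Γ F i → Contains F C → Contains F D →
                      C ≗ᶜ D ⊎ C ∼[ i ] D
  corank-one-≗-or-∼ {F} {i} {C} {D} co@(i-free , others) C∋F D∋F
    with residue-≡-or-≢ F i co (in-res-chamber C∋F i i-free) (in-res-chamber D∋F i i-free)
  ... | inj₁ Ci≡Di = inj₁ C≗D
    where
    C≗D : C ≗ᶜ D
    C≗D j with j ≟ i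
    ... | yes refl = Ci≡Di
    ... | no  j≢i  = contains-agree C∋F D∋F j (others j j≢i)
  ... | inj₂ Ci≢Di = inj₂ (adjacent (λ j j≢i → contains-agree C∋F D∋F j (others j j≢i)) Ci≢Di)

module Connectivity {n : ℕ} (Γ : IncidenceSystem n) (geometry : IsGeometry Γ) (thin : Thin Γ)
                    (resConn : ResiduallyConnected Γ) where
  open IncidenceSystem Γ
  open Chamber renaming (c to _at_)
  open ChamberSystem Γ
  open Thinness Γ thin

  chamber-through : ∀ F → ∃ (Contains F)
  chamber-through F = let E , E∋F = geometry F in E , contains E∋F

  ResidueGallery : Flag Γ → Chamber Γ → Chamber Γ → Set
  ResidueGallery F C D = ∃ (Gallery (Contains F) C D)

  -- In corank one thinness leaves C and D equal or adjacent.
  -- In corank ≥ 2 a path from C i to D i in the residue of F is followed: consecutive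
  -- elements x, z of the path lie in a common chamber, reached from the previous one
  -- inside the residue of F ∪ {x}, which has smaller corank.
  mutual
    residue-gallery-≤ : ∀ k F → corank F ≤ k → ∀ {C D} → Contains F C → Contains F D →
                        ResidueGallery F C D
    residue-gallery-≤ k F F≤k C∋F D∋F with any? (free? F)
    ... | no no-free =
      [] , stop (λ j → contains-agree C∋F D∋F j (¬free⇒is-just F j (λ Fj → no-free (j , Fj))))
    ... | yes (i , Fi) with any? (λ j → ¬? (j ≟ i) ×-dec free? F j)
    ...   | no only-i with corank-one-≗-or-∼ co C∋F D∋F
      where
      co : CorankOne Γ F i
      co = Fi , λ j j≢i → ¬free⇒is-just F j (λ Fj → only-i (j , j≢i , Fj))
    ...     | inj₁ C≗D = [] , stop C≗D
    ...     | inj₂ C∼D = i ∷ [] , step C∼D D∋F (stop (λ _ → refl))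
    residue-gallery-≤ zero F F≤0 C∋F D∋F | yes (i , Fi) | yes _ =
      ⊥-elim (corank-≢0 {F} (in-res-chamber C∋F i Fi) F≤0)
    residue-gallery-≤ (suc k) F F≤ {C} {D} C∋F D∋F | yes (i , Fi) | yes (j , j≢i , Fj) =
      path-gallery k F F≤ path rCi C∋F D∋F (cong (C at_) (typed C i)) (cong (D at_) (typed D i))
      where
      rCi = in-res-chamber C∋F i Fi
      path = resConn F (i , j , (λ i≡j → j≢i (sym i≡j)) , Fi , Fj) (C at i) (D at i)
                     rCi (in-res-chamber D∋F i Fi)

    path-gallery : ∀ k F → corank F ≤ suc k → ∀ {x y C D} → PathIn Γ (InRes F) x y → InRes F x →
                   Contains F C → Contains F D → C at t x ≡ x → D at t y ≡ y → ResidueGallery F C D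
    path-gallery k F F≤ {x} here rx C∋F D∋F Cx Dx =
      let w , γ = residue-gallery-≤ k (extend F x rx) (corank-extend-≤ {F} rx F≤)
                    (contains-extend rx C∋F Cx) (contains-extend rx D∋F Dx)
      in w , gallery-map (contains-extend⁻ rx) γ
    path-gallery k F F≤ {x} {C = C} (step {y = z} x*z rz path) rx C∋F D∋F Cx Dy
      with t z ≟ t x
    ... | yes tz≡tx =
      path-gallery k F F≤ path rz C∋F D∋F
        (trans (cong (C at_) tz≡tx) (trans Cx (*-type x*z (sym tz≡tx)))) Dy
    ... | no tz≢tx
      with chamber-through (extend (extend F x rx) z (in-res-extend {F} rx rz tz≢tx x*z))
    ...   | E , E∋F+x+z =
      proj₁ C→E ++ proj₁ E→D ,
      gallery-++ (gallery-map (contains-extend⁻ rx) (proj₂ C→E)) (proj₂ E→D)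
      where
      rz′ = in-res-extend {F} rx rz tz≢tx x*z
      E∋F+x = contains-extend⁻ rz′ E∋F+x+z
      Ez≡z : E at t z ≡ z
      Ez≡z = agrees E∋F+x+z (t z) z (extend-at (extend F x rx) z rz′)
      C→E = residue-gallery-≤ k (extend F x rx) (corank-extend-≤ {F} rx F≤)
              (contains-extend rx C∋F Cx) E∋F+x
      E→D = path-gallery k F F≤ path rz (contains-extend⁻ rx E∋F+x) D∋F Ez≡z Dy

  residue-gallery : ∀ F {C D} → Contains F C → Contains F D → ResidueGallery F C D
  residue-gallery F = residue-gallery-≤ (corank F) F ≤-refl

  gallery : ∀ C D → ResidueGallery ∅ C D
  gallery C D = residue-gallery ∅ (contains λ _ _ ()) (contains λ _ _ ())

  agreement-spreads : ∀ α β {P C D w} → Gallery P C D w →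
                      image α C ≗ᶜ image β C → image α D ≗ᶜ image β D
  agreement-spreads α β (stop C≗D) αC≗βC j =
    trans (cong (α ⊳_) (sym (C≗D j))) (trans (αC≗βC j) (cong (β ⊳_) (C≗D j)))
  agreement-spreads α β (step C∼D _ rest) αC≗βC =
    agreement-spreads α β rest
      (adjacent-unique (image-∼ α C∼D) (∼-respˡ (λ j → sym (αC≗βC j)) (image-∼ β C∼D)))

  ≋-from-chamber : ∀ α β C → image α C ≗ᶜ image β C → α ≋ β
  ≋-from-chamber α β C αC≗βC x =
    let D , D∋x = chamber-through (single x)
    in subst (λ y → α ⊳ y ≡ β ⊳ y) (agrees D∋x (t x) x (single-at x))
             (agreement-spreads α β (proj₂ (gallery C D)) αC≗βC (t x))

module StandardGenerators {n : ℕ} (Γ : IncidenceSystem n) (geometry : IsGeometry Γ) (thin : Thin Γ)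
                          (resConn : ResiduallyConnected Γ) (C₀ : Chamber Γ) (ρ : Fin n → Aut Γ)
                          (std : ∀ i → IsStdGen Γ C₀ i (ρ i)) where
  open IncidenceSystem Γ
  open Chamber renaming (c to _at_)
  open ChamberSystem Γ
  open Thinness Γ thin
  open Connectivity Γ geometry thin resConn

  E : List (Fin n) → G
  E = evalWord Γ ρ

  ε : G
  ε = idA Γ

  ρ-fixes : ∀ {i} j → j ≢ i → ρ i ⊳ C₀ at j ≡ C₀ at j
  ρ-fixes {i} = proj₁ (std i)

  C₀∼ρC₀ : ∀ i → C₀ ∼[ i ] image (ρ i) C₀
  C₀∼ρC₀ i = adjacent (λ j j≢i → sym (ρ-fixes j j≢i)) (λ eq → proj₂ (std i) (sym eq))

  gallery-word : ∀ g {P C D w} → Gallery P C D w → C ≗ᶜ image g C₀ → D ≗ᶜ image (g · E w) C₀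
  gallery-word g (stop C≗D) C≗gC₀ j = trans (sym (C≗D j)) (C≗gC₀ j)
  gallery-word g (step {i = i} C∼D _ rest) C≗gC₀ =
    gallery-word (g · ρ i) rest
      (adjacent-unique C∼D (∼-respˡ (λ j → sym (C≗gC₀ j)) (image-∼ g (C₀∼ρC₀ i))))

  chamber-word : ∀ D → ∃ λ w → D ≗ᶜ image (E w) C₀
  chamber-word D = let w , γ = gallery C₀ D in w , gallery-word ε γ (λ _ → refl)

  evalWord-onto : ∀ α → ∃ λ w → α ≋ E w
  evalWord-onto α =
    let w , αC₀≗ = chamber-word (image α C₀) in w , ≋-from-chamber α (E w) C₀ αC₀≗

  transitive-on-type : ∀ x → ∃ λ g → g ⊳ C₀ at t x ≡ x
  transitive-on-type x =
    let D , D∋x = chamber-through (single x)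
        w , D≗  = chamber-word D
    in E w , trans (sym (D≗ (t x))) (agrees D∋x (t x) x (single-at x))

  ρ-involutive : ∀ i → ρ i · ρ i ≋ ε
  ρ-involutive i = ≋-from-chamber (ρ i · ρ i) ε C₀
    (adjacent-unique (image-∼ (ρ i) (C₀∼ρC₀ i)) (∼-sym (C₀∼ρC₀ i)))

  ρ⁻¹≋ρ : ∀ i → invA Γ (ρ i) ≋ ρ i
  ρ⁻¹≋ρ i x = trans (cong (Aut.from (ρ i)) (sym (ρ-involutive i x))) (Aut.from-to (ρ i) (ρ i ⊳ x))

  evalWord-++ : ∀ u v → E (u ++ v) ≋ E u · E v
  evalWord-++ []      v x = refl
  evalWord-++ (i ∷ u) v x = cong (ρ i ⊳_) (evalWord-++ u v x)

  evalWord-reverse : ∀ w → E w · E (reverse w) ≋ ε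
  evalWord-reverse []      x = refl
  evalWord-reverse (i ∷ w) x = begin
    ρ i ⊳ E w ⊳ E (reverse (i ∷ w)) ⊳ x
      ≡⟨ cong (λ u → ρ i ⊳ E w ⊳ E u ⊳ x) (unfold-reverse i w) ⟩
    ρ i ⊳ E w ⊳ E (reverse w ++ i ∷ []) ⊳ x
      ≡⟨ cong (λ y → ρ i ⊳ E w ⊳ y) (evalWord-++ (reverse w) (i ∷ []) x) ⟩
    ρ i ⊳ E w ⊳ E (reverse w) ⊳ ρ i ⊳ x
      ≡⟨ cong (ρ i ⊳_) (evalWord-reverse w (ρ i ⊳ x)) ⟩
    ρ i ⊳ ρ i ⊳ x
      ≡⟨ ρ-involutive i x ⟩
    x ∎
    where open ≡-Reasoning

  same-image⇒avoiding-word : ∀ g h i → g ⊳ C₀ at i ≡ h ⊳ C₀ at i →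
                             ∃ λ w → All (_≢ i) w × g ≋ h · E w
  same-image⇒avoiding-word g h i gCi≡hCi =
    w , gallery-avoids Fi hC₀∋F γ , ≋-from-chamber g (h · E w) C₀ (gallery-word h γ (λ _ → refl))
    where
    y = h ⊳ C₀ at i
    ty≡i : t y ≡ i
    ty≡i = trans (⊳-type h (C₀ at i)) (typed C₀ i)
    Fi : Flag.f (single y) i ≡ just y
    Fi = subst (λ k → Flag.f (single y) k ≡ just y) ty≡i (single-at y)
    hC₀∋F : Contains (single y) (image h C₀)
    hC₀∋F = contains-single (cong (λ k → h ⊳ C₀ at k) ty≡i)
    gC₀∋F : Contains (single y) (image g C₀)
    gC₀∋F = contains-single (trans (cong (λ k → g ⊳ C₀ at k) ty≡i) gCi≡hCi)
    w = proj₁ (residue-gallery (single y) hC₀∋F gC₀∋F)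
    γ = proj₂ (residue-gallery (single y) hC₀∋F gC₀∋F)

module _ {n : ℕ} {Γ : IncidenceSystem n} (ψ : HomToZ2 Γ) where
  open HomToZ2 ψ

  φ-idA : φ (idA Γ) ≡ false
  φ-idA = trans (sym (φ-resp {_∘A_ Γ (idA Γ) (idA Γ)} (λ _ → refl)))
                (trans (φ-hom (idA Γ) (idA Γ)) (xor-same (φ (idA Γ))))

  φ-invA : ∀ g → φ (invA Γ g) ≡ φ g
  φ-invA g = xor≡false⇒≡ (begin
    φ (invA Γ g) xor φ g    ≡⟨ φ-hom (invA Γ g) g ⟨
    φ (_∘A_ Γ (invA Γ g) g) ≡⟨ φ-resp (Aut.from-to g) ⟩
    φ (idA Γ)               ≡⟨ φ-idA ⟩
    false                   ∎)
    where open ≡-Reasoning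

module _ {n : ℕ} (Γ : IncidenceSystem (suc n)) (ρ : Fin (suc n) → Aut Γ) where

  IsParityHom : HomToZ2 Γ → Set
  IsParityHom ψ = HomToZ2.φ ψ (ρ zero) ≡ true × (∀ i → i ≢ zero → HomToZ2.φ ψ (ρ i) ≡ false)

  EvenRelators : Set
  EvenRelators = ∀ w → IsRelator Γ ρ w → 2 ∣ count0 w

  module _ (ψ : HomToZ2 Γ) where
    open HomToZ2 ψ

    φ-evalWord : IsParityHom ψ → ∀ w → φ (evalWord Γ ρ w) ≡ odd (count0 w)
    φ-evalWord _              []          = φ-idA ψ
    φ-evalWord par@(φρ₀ , _)  (zero ∷ w)  =
      trans (φ-hom (ρ zero) _) (cong₂ _xor_ φρ₀ (φ-evalWord par w))
    φ-evalWord par@(_ , φρᵢ)  (suc i ∷ w) =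
      trans (φ-hom (ρ (suc i)) _) (cong₂ _xor_ (φρᵢ (suc i) (λ ())) (φ-evalWord par w))

  parity-hom⇒even-relators : Σ (HomToZ2 Γ) IsParityHom → EvenRelators
  parity-hom⇒even-relators (ψ , par) w w≋id =
    even⇒2∣ _ (trans (sym (φ-evalWord ψ par w)) (trans (φ-resp w≋id) (φ-idA ψ)))
    where open HomToZ2 ψ

module RelatorParity {n : ℕ} (Γ : IncidenceSystem (suc n)) (geometry : IsGeometry Γ) (thin : Thin Γ)
                     (resConn : ResiduallyConnected Γ) (C₀ : Chamber Γ) (ρ : Fin (suc n) → Aut Γ)
                     (std : ∀ i → IsStdGen Γ C₀ i (ρ i)) where
  open ChamberSystem Γ
  open StandardGenerators Γ geometry thin resConn C₀ ρ std

  module _ (even : EvenRelators Γ ρ) where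

    parity-well-defined : ∀ u v → E u ≋ E v → odd (count0 u) ≡ odd (count0 v)
    parity-well-defined u v Eu≋Ev = xor≡false⇒≡ (begin
      odd (count0 u) xor odd (count0 v)    ≡⟨ odd-+ (count0 u) (count0 v) ⟨
      odd (count0 u + count0 v)            ≡⟨ cong (λ k → odd (count0 u + k)) (count0-reverse v) ⟨
      odd (count0 u + count0 (reverse v))  ≡⟨ cong odd (count0-++ u (reverse v)) ⟨
      odd (count0 (u ++ reverse v))        ≡⟨ 2∣⇒even _ (even (u ++ reverse v) relator) ⟩
      false                                ∎)
      where
      open ≡-Reasoning
      relator : IsRelator Γ ρ (u ++ reverse v)
      relator x = trans (evalWord-++ u (reverse v) x)
                        (trans (Eu≋Ev (E (reverse v) ⊳ x)) (evalWord-reverse v x))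

    word-parity : G → Bool
    word-parity g = odd (count0 (proj₁ (evalWord-onto g)))

    word-parity-≋ : ∀ {g} w → g ≋ E w → word-parity g ≡ odd (count0 w)
    word-parity-≋ {g} w g≋Ew = let u , g≋Eu = evalWord-onto g in
      parity-well-defined u w (λ x → trans (sym (g≋Eu x)) (g≋Ew x))

    word-parity-resp : ∀ {g h} → g ≋ h → word-parity g ≡ word-parity h
    word-parity-resp {g} {h} g≋h = let v , h≋Ev = evalWord-onto h in
      word-parity-≋ {g} v (λ x → trans (g≋h x) (h≋Ev x))

    word-parity-hom : HomToZ2 Γ
    word-parity-hom = record
      { φ = word-parity ; φ-resp = λ {g} {h} → word-parity-resp {g} {h} ; φ-hom = hom }
      where
      hom : ∀ g h → word-parity (g · h) ≡ word-parity g xor word-parity h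
      hom g h = begin
        word-parity (g · h)                ≡⟨ word-parity-≋ {g · h} (u ++ v) gh≋Euv ⟩
        odd (count0 (u ++ v))              ≡⟨ cong odd (count0-++ u v) ⟩
        odd (count0 u + count0 v)          ≡⟨ odd-+ (count0 u) (count0 v) ⟩
        odd (count0 u) xor odd (count0 v)  ∎
        where
        open ≡-Reasoning
        u = proj₁ (evalWord-onto g)
        v = proj₁ (evalWord-onto h)
        gh≋Euv : g · h ≋ E (u ++ v)
        gh≋Euv x = trans (proj₂ (evalWord-onto g) (h ⊳ x))
          (trans (cong (E u ⊳_) (proj₂ (evalWord-onto h) x)) (sym (evalWord-++ u v x)))

  even-relators⇒parity-hom : EvenRelators Γ ρ → Σ (HomToZ2 Γ) (IsParityHom Γ ρ)
  even-relators⇒parity-hom even = word-parity-hom even , generator-parity zero , other-generators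
    where
    generator-parity : ∀ i → word-parity even (ρ i) ≡ odd (count0 (i ∷ []))
    generator-parity i = word-parity-≋ even {ρ i} (i ∷ []) (λ _ → refl)

    other-generators : ∀ i → i ≢ zero → word-parity even (ρ i) ≡ false
    other-generators zero    0≢0 = ⊥-elim (0≢0 refl)
    other-generators (suc i) _   = generator-parity (suc i)

module _ {m : ℕ} (Γ : IncidenceSystem (suc (suc m))) (b1 : B1 Γ) where
  open IncidenceSystem Γ

  other-vertex-unique : ∀ {e u v w} → t e ≡ suc zero → t u ≡ zero → t v ≡ zero → t w ≡ zero →
                        u * e → v * e → w * e → u ≢ v → u ≢ w → v ≡ w
  other-vertex-unique te tu tv tw u*e v*e w*e with proj₁ b1 _ te
  ... | _ , _ , _ , _ , _ , _ , _ , two = other-unique (two _ tu u*e) (two _ tv v*e) (two _ tw w*e)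

module Bipartition {m : ℕ} (Γ : IncidenceSystem (suc (suc m))) (geometry : IsGeometry Γ)
                   (thin : Thin Γ) (resConn : ResiduallyConnected Γ) (C₀ : Chamber Γ)
                   (ρ : Fin (suc (suc m)) → Aut Γ) (std : ∀ i → IsStdGen Γ C₀ i (ρ i)) where
  open IncidenceSystem Γ
  open Chamber renaming (c to _at_)
  open ChamberSystem Γ
  open Connectivity Γ geometry thin resConn
  open StandardGenerators Γ geometry thin resConn C₀ ρ std

  v₀ : X
  v₀ = C₀ at zero

  ∼₀⇒adjacent : ∀ {C D} → C ∼[ zero ] D → Adjacent Γ (C at zero) (D at zero)
  ∼₀⇒adjacent {C} {D} (adjacent agree differ) =
    typed C zero , typed D zero , differ , C at suc zero , typed C (suc zero) ,
    pairw C zero (suc zero) ,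
    subst (λ e → (D at zero) * e) (sym (agree (suc zero) (λ ()))) (pairw D zero (suc zero))

  module _ (colour : X → Bool) (proper : ∀ u v → Adjacent Γ u v → colour u ≢ colour v) where

    recolouring : G → Chamber Γ → Bool
    recolouring g C = colour (g ⊳ C at zero) xor colour (C at zero)

    recolouring-constant : ∀ g {P C D w} → Gallery P C D w → recolouring g C ≡ recolouring g D
    recolouring-constant g (stop C≗D) = cong (λ x → colour (g ⊳ x) xor colour x) (C≗D zero)
    recolouring-constant g (step {i = zero} C∼D _ rest) =
      trans (xor-≢ (proper _ _ (∼₀⇒adjacent C∼D)) (proper _ _ (∼₀⇒adjacent (image-∼ g C∼D))))
            (recolouring-constant g rest)
    recolouring-constant g (step {i = suc _} C∼D _ rest) =
      trans (cong (λ x → colour (g ⊳ x) xor colour x) (_∼[_]_.agree C∼D zero (λ ())))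
            (recolouring-constant g rest)

    recolouring-hom : HomToZ2 Γ
    recolouring-hom = record
      { φ      = λ g → recolouring g C₀
      ; φ-resp = λ g≋h → cong (_xor colour v₀) (cong colour (g≋h v₀))
      ; φ-hom  = hom
      }
      where
      hom : ∀ g h → recolouring (g · h) C₀ ≡ recolouring g C₀ xor recolouring h C₀
      hom g h = trans (xor-telescope (colour (g ⊳ h ⊳ v₀)) (colour (h ⊳ v₀)) (colour v₀))
        (cong (_xor recolouring h C₀)
              (sym (recolouring-constant g (proj₂ (gallery C₀ (image h C₀))))))

  bipartite⇒parity-hom : Bipartite𝒢 Γ → Σ (HomToZ2 Γ) (IsParityHom Γ ρ)
  bipartite⇒parity-hom (colour , proper) = recolouring-hom colour proper , flips , fixes
    where
    flips : colour (ρ zero ⊳ v₀) xor colour v₀ ≡ true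
    flips = trans (cong (_xor colour v₀)
                        (¬-not (λ eq → proper _ _ (∼₀⇒adjacent (C₀∼ρC₀ zero)) (sym eq))))
                  (xor-inverseˡ (colour v₀))

    fixes : ∀ i → i ≢ zero → colour (ρ i ⊳ v₀) xor colour v₀ ≡ false
    fixes i i≢0 = trans (cong (λ x → colour x xor colour v₀) (ρ-fixes zero (i≢0 ∘ sym)))
                        (xor-same (colour v₀))

  module _ (ψ : HomToZ2 Γ) (par : IsParityHom Γ ρ ψ) where
    open HomToZ2 ψ

    φ-vertex-stable : ∀ g h → g ⊳ v₀ ≡ h ⊳ v₀ → φ g ≡ φ h
    φ-vertex-stable g h gv₀≡hv₀ =
      let w , avoids-0 , g≋hEw = same-image⇒avoiding-word g h zero gv₀≡hv₀
      in begin
        φ g                     ≡⟨ φ-resp g≋hEw ⟩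
        φ (h · E w)             ≡⟨ φ-hom h (E w) ⟩
        φ h xor φ (E w)         ≡⟨ cong (φ h xor_) (φ-evalWord Γ ρ ψ par w) ⟩
        φ h xor odd (count0 w)  ≡⟨ cong (λ k → φ h xor odd k) (count0-avoiding avoids-0) ⟩
        φ h xor false           ≡⟨ xor-identityʳ (φ h) ⟩
        φ h                     ∎
      where open ≡-Reasoning

  module _ (b1 : B1 Γ) where

    adjacent⇒ρ₀-related : ∀ {u v} → Adjacent Γ u v →
                          ∃ λ g → g ⊳ v₀ ≡ u × (g · ρ zero) ⊳ v₀ ≡ v
    adjacent⇒ρ₀-related {u} {v} (tu , tv , u≢v , e , te , u*e , v*e) = g , gv₀≡u , gρ₀v₀≡v
      where
      te≢tu : t e ≢ t u
      te≢tu te≡tu = case trans (sym te) (trans te≡tu tu) of λ ()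
      re = in-res-extend {∅} (in-res-∅ u) (in-res-∅ e) te≢tu u*e
      F = extend (single u) e re
      D = proj₁ (chamber-through F)
      D∋F = proj₂ (chamber-through F)
      g = E (proj₁ (chamber-word D))
      D≗gC₀ = proj₂ (chamber-word D)
      gv₀≡u : g ⊳ v₀ ≡ u
      gv₀≡u = trans (sym (D≗gC₀ zero)) (trans (cong (D at_) (sym tu))
                (agrees (contains-extend⁻ re D∋F) (t u) u (single-at u)))
      ge₀≡e : g ⊳ C₀ at suc zero ≡ e
      ge₀≡e = trans (sym (D≗gC₀ (suc zero)))
                (trans (cong (D at_) (sym te)) (agrees D∋F (t e) e (extend-at (single u) e re)))
      w = (g · ρ zero) ⊳ v₀
      w*e : w * e
      w*e = subst (λ x → w * x) (trans (cong (g ⊳_) (ρ-fixes (suc zero) (λ ()))) ge₀≡e)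
                  (pairw (image (g · ρ zero) C₀) zero (suc zero))
      u≢w : u ≢ w
      u≢w u≡w = proj₂ (std zero) (sym (⊳-injective g (trans gv₀≡u u≡w)))
      gρ₀v₀≡v : w ≡ v
      gρ₀v₀≡v = sym (other-vertex-unique Γ b1 te tu tv (typed (image (g · ρ zero) C₀) zero)
                                         u*e v*e w*e u≢v u≢w)

    parity-hom⇒bipartite : Σ (HomToZ2 Γ) (IsParityHom Γ ρ) → Bipartite𝒢 Γ
    parity-hom⇒bipartite (ψ , par@(φρ₀ , _)) = colour , proper
      where
      open HomToZ2 ψ

      colour : X → Bool
      colour x = φ (proj₁ (transitive-on-type x))

      colour-vertex : ∀ {u} g → t u ≡ zero → g ⊳ v₀ ≡ u → colour u ≡ φ g
      colour-vertex {u} g tu gv₀≡u =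
        let h , hCu≡u = transitive-on-type u
        in φ-vertex-stable ψ par h g
             (trans (cong (λ k → h ⊳ C₀ at k) (sym tu)) (trans hCu≡u (sym gv₀≡u)))

      proper : ∀ u v → Adjacent Γ u v → colour u ≢ colour v
      proper u v u~v@(tu , tv , _) cu≡cv = not-¬ refl (trans cu≡cv cv≡¬cu)
        where
        open ≡-Reasoning
        related = adjacent⇒ρ₀-related u~v
        g = proj₁ related
        cv≡¬cu : colour v ≡ not (colour u)
        cv≡¬cu = begin
          colour v            ≡⟨ colour-vertex (g · ρ zero) tv (proj₂ (proj₂ related)) ⟩
          φ (g · ρ zero)      ≡⟨ φ-hom g (ρ zero) ⟩
          φ g xor φ (ρ zero)  ≡⟨ cong (φ g xor_) φρ₀ ⟩
          φ g xor true        ≡⟨ xor-comm (φ g) true ⟩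
          not (φ g)           ≡⟨ cong not (colour-vertex g tu (proj₁ (proj₂ related))) ⟨
          not (colour u)      ∎

module Halving {m : ℕ} (Γ : IncidenceSystem (suc (suc m))) (geometry : IsGeometry Γ)
               (thin : Thin Γ) (resConn : ResiduallyConnected Γ) (b1 : B1 Γ) (b2 : B2 Γ)
               (C₀ : Chamber Γ) (ρ : Fin (suc (suc m)) → Aut Γ)
               (std : ∀ i → IsStdGen Γ C₀ i (ρ i)) where
  open IncidenceSystem Γ
  open Chamber renaming (c to _at_)
  open ChamberSystem Γ
  open Thinness Γ thin
  open Connectivity Γ geometry thin resConn
  open StandardGenerators Γ geometry thin resConn C₀ ρ std

  H : G → Set
  H = HalvingGroup Γ ρ

  -- With e₀ = C₀ at 1 and xᵢ = C₀ at i: ρᵢ fixes e₀ and v₀, hence by (B1) also the other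
  -- vertex ρ₀ v₀ of e₀. And ρ₀ ρᵢ xᵢ is incident to e₀, hence by (B2) to v₀; so it lies in
  -- the i-panel residue of C₀, whose only elements are xᵢ and ρᵢ xᵢ.
  module _ (i : Fin (suc (suc m))) (i≢0 : i ≢ zero) (i≢1 : i ≢ suc zero) where

    ρᵢ-fixes-ρ₀v₀ : ρ i ⊳ ρ zero ⊳ C₀ at zero ≡ ρ zero ⊳ C₀ at zero
    ρᵢ-fixes-ρ₀v₀ = sym (other-vertex-unique Γ b1 (typed C₀ (suc zero))
      (typed C₀ zero) (typed (image (ρ zero) C₀) zero) (typed (image (ρ i · ρ zero) C₀) zero)
      (pairw C₀ zero (suc zero)) ρ₀v₀*e₀ ρᵢρ₀v₀*e₀ v₀≢ρ₀v₀ v₀≢ρᵢρ₀v₀)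
      where
      ρ₀e₀≡e₀ : ρ zero ⊳ C₀ at suc zero ≡ C₀ at suc zero
      ρ₀e₀≡e₀ = ρ-fixes (suc zero) (λ ())
      ρ₀v₀*e₀ : (ρ zero ⊳ C₀ at zero) * (C₀ at suc zero)
      ρ₀v₀*e₀ = subst (λ x → (ρ zero ⊳ C₀ at zero) * x) ρ₀e₀≡e₀
                      (pairw (image (ρ zero) C₀) zero (suc zero))
      ρᵢρ₀v₀*e₀ : (ρ i ⊳ ρ zero ⊳ C₀ at zero) * (C₀ at suc zero)
      ρᵢρ₀v₀*e₀ = subst (λ x → (ρ i ⊳ ρ zero ⊳ C₀ at zero) * x)
                        (trans (cong (ρ i ⊳_) ρ₀e₀≡e₀) (ρ-fixes (suc zero) (i≢1 ∘ sym)))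
                        (pairw (image (ρ i · ρ zero) C₀) zero (suc zero))
      v₀≢ρ₀v₀ : C₀ at zero ≢ ρ zero ⊳ C₀ at zero
      v₀≢ρ₀v₀ eq = proj₂ (std zero) (sym eq)
      v₀≢ρᵢρ₀v₀ : C₀ at zero ≢ ρ i ⊳ ρ zero ⊳ C₀ at zero
      v₀≢ρᵢρ₀v₀ eq = v₀≢ρ₀v₀ (⊳-injective (ρ i) (trans (ρ-fixes zero (i≢0 ∘ sym)) eq))

    ρ₀-fixes-ρᵢxᵢ : ρ zero ⊳ ρ i ⊳ C₀ at i ≡ ρ i ⊳ C₀ at i
    ρ₀-fixes-ρᵢxᵢ = sym (residue-other-unique (panel C₀ i) i (panel-corank-one C₀ i)
      (in-res-panel C₀ i (typed C₀ i) (λ l _ → pairw C₀ i l))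
      (in-res-panel C₀ i (typed (image (ρ i) C₀) i) ρᵢxᵢ*C₀)
      (in-res-panel C₀ i (typed (image (ρ zero · ρ i) C₀) i) ρ₀ρᵢxᵢ*C₀)
      xᵢ≢ρᵢxᵢ xᵢ≢ρ₀ρᵢxᵢ)
      where
      ρᵢxᵢ*C₀ : ∀ l → l ≢ i → (ρ i ⊳ C₀ at i) * (C₀ at l)
      ρᵢxᵢ*C₀ l l≢i =
        subst (λ x → (ρ i ⊳ C₀ at i) * x) (ρ-fixes l l≢i) (pairw (image (ρ i) C₀) i l)
      ρ₀ρᵢxᵢ*C₀-off-0 : ∀ l → l ≢ i → l ≢ zero → (ρ zero ⊳ ρ i ⊳ C₀ at i) * (C₀ at l)
      ρ₀ρᵢxᵢ*C₀-off-0 l l≢i l≢0 =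
        subst (λ x → (ρ zero ⊳ ρ i ⊳ C₀ at i) * x) (ρ-fixes l l≢0) (⊳-* (ρ zero) (ρᵢxᵢ*C₀ l l≢i))
      ρ₀ρᵢxᵢ*C₀ : ∀ l → l ≢ i → (ρ zero ⊳ ρ i ⊳ C₀ at i) * (C₀ at l)
      ρ₀ρᵢxᵢ*C₀ l l≢i with l ≟ zero
      ... | no  l≢0  = ρ₀ρᵢxᵢ*C₀-off-0 l l≢i l≢0
      ... | yes refl = *-sym (Equivalence.to
              (b2 (C₀ at suc zero) _ (typed C₀ (suc zero)) (λ eq → i≢0 (trans (sym ty≡i) eq))
                  (λ eq → i≢1 (trans (sym ty≡i) eq)))
              (*-sym (ρ₀ρᵢxᵢ*C₀-off-0 (suc zero) (i≢1 ∘ sym) (λ ())))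
              (C₀ at zero) (typed C₀ zero) (pairw C₀ zero (suc zero)))
        where
        ty≡i = typed (image (ρ zero · ρ i) C₀) i
      xᵢ≢ρᵢxᵢ : C₀ at i ≢ ρ i ⊳ C₀ at i
      xᵢ≢ρᵢxᵢ eq = proj₂ (std i) (sym eq)
      xᵢ≢ρ₀ρᵢxᵢ : C₀ at i ≢ ρ zero ⊳ ρ i ⊳ C₀ at i
      xᵢ≢ρ₀ρᵢxᵢ eq = xᵢ≢ρᵢxᵢ (⊳-injective (ρ zero) (trans (ρ-fixes i i≢0) eq))

    ρ₀-ρᵢ-commute : ρ zero · ρ i ≋ ρ i · ρ zero
    ρ₀-ρᵢ-commute = ≋-from-chamber (ρ zero · ρ i) (ρ i · ρ zero) C₀ agree-on-C₀
      where
      agree-on-C₀ : ∀ j → ρ zero ⊳ ρ i ⊳ C₀ at j ≡ ρ i ⊳ ρ zero ⊳ C₀ at j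
      agree-on-C₀ j with j ≟ zero | j ≟ i
      ... | yes refl | _ = trans (cong (ρ zero ⊳_) (ρ-fixes zero (i≢0 ∘ sym))) (sym ρᵢ-fixes-ρ₀v₀)
      ... | no _ | yes refl = trans ρ₀-fixes-ρᵢxᵢ (cong (ρ i ⊳_) (sym (ρ-fixes i i≢0)))
      ... | no j≢0 | no j≢i = trans (cong (ρ zero ⊳_) (ρ-fixes j j≢i))
        (trans (ρ-fixes j j≢0) (sym (trans (cong (ρ i ⊳_) (ρ-fixes j j≢0)) (ρ-fixes j j≢i))))

  ρᵢ∈H : ∀ i → i ≢ zero → H (ρ i)
  ρᵢ∈H i i≢0 = gen {g = ρ i} (inj₂ (i , i≢0 , λ _ → refl))

  ρ₀ρᵢρ₀∈H : ∀ i → i ≢ zero → H (ρ zero · ρ i · ρ zero)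
  ρ₀ρᵢρ₀∈H zero          0≢0 = ⊥-elim (0≢0 refl)
  ρ₀ρᵢρ₀∈H (suc zero)    _   = gen (inj₁ (λ _ → refl))
  ρ₀ρᵢρ₀∈H (suc (suc k)) _   = resp conjugate (ρᵢ∈H (suc (suc k)) (λ ()))
    where
    i = suc (suc k)
    conjugate : ρ i ≋ ρ zero · ρ i · ρ zero
    conjugate x = sym (trans (ρ₀-ρᵢ-commute i (λ ()) (λ ()) (ρ zero ⊳ x))
                             (cong (ρ i ⊳_) (ρ-involutive zero x)))

  parity-coset : ∀ w → (odd (count0 w) ≡ false → H (E w))
                     × (odd (count0 w) ≡ true  → H (ρ zero · E w))
  parity-coset [] = (λ _ → unit) , λ ()
  parity-coset (zero ∷ w) =
    let on-even , on-odd = parity-coset w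
    in (λ p → on-odd (not-injective p)) ,
       (λ p → resp (λ x → sym (ρ-involutive zero (E w ⊳ x))) (on-even (not-injective p)))
  parity-coset (suc i ∷ w) =
    let on-even , on-odd = parity-coset w
    in (λ p → comp (ρᵢ∈H (suc i) (λ ())) (on-even p)) ,
       (λ p → resp (λ x → cong (λ y → ρ zero ⊳ ρ (suc i) ⊳ y) (ρ-involutive zero (E w ⊳ x)))
                   (comp (ρ₀ρᵢρ₀∈H (suc i) (λ ())) (on-odd p)))

  H-cosets : ∀ x → H x ⊎ H (invA Γ (ρ zero) · x)
  H-cosets x with evalWord-onto x
  ... | w , x≋Ew with odd (count0 w) in parity
  ...   | false = inj₁ (resp (λ y → sym (x≋Ew y)) (proj₁ (parity-coset w) parity))
  ...   | true  = inj₂ (resp ρ₀Ew≋ρ₀⁻¹x (proj₂ (parity-coset w) parity))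
    where
    ρ₀Ew≋ρ₀⁻¹x : ρ zero · E w ≋ invA Γ (ρ zero) · x
    ρ₀Ew≋ρ₀⁻¹x y = trans (cong (ρ zero ⊳_) (sym (x≋Ew y))) (sym (ρ⁻¹≋ρ zero (x ⊳ y)))

  ρ₀∈H⇒H-total : H (ρ zero) → ∀ x → H x
  ρ₀∈H⇒H-total ρ₀∈H x with H-cosets x
  ... | inj₁ x∈H     = x∈H
  ... | inj₂ ρ₀⁻¹x∈H = resp (λ y → Aut.to-from (ρ zero) (x ⊳ y)) (comp ρ₀∈H ρ₀⁻¹x∈H)

  module _ (ψ : HomToZ2 Γ) (par : IsParityHom Γ ρ ψ) where
    open HomToZ2 ψ

    H⊆ker : ∀ {x} → H x → φ x ≡ false
    H⊆ker (gen (inj₁ x≋ρ₀ρ₁ρ₀)) = trans (φ-resp x≋ρ₀ρ₁ρ₀) (trans (φ-hom _ _)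
      (cong₂ _xor_ φρ₀ (trans (φ-hom _ _) (cong₂ _xor_ (proj₂ par (suc zero) (λ ())) φρ₀))))
      where φρ₀ = proj₁ par
    H⊆ker (gen (inj₂ (i , i≢0 , x≋ρᵢ))) = trans (φ-resp x≋ρᵢ) (proj₂ par i i≢0)
    H⊆ker unit            = φ-idA ψ
    H⊆ker (comp g∈H h∈H)  = trans (φ-hom _ _) (cong₂ _xor_ (H⊆ker g∈H) (H⊆ker h∈H))
    H⊆ker (inv {g} g∈H)   = trans (φ-invA ψ g) (H⊆ker g∈H)
    H⊆ker (resp g≋h g∈H)  = trans (sym (φ-resp g≋h)) (H⊆ker g∈H)

  parity-hom⇒index-2 : Σ (HomToZ2 Γ) (IsParityHom Γ ρ) → HasIndex2 Γ H
  parity-hom⇒index-2 (ψ , par) =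
    ρ zero , (λ ρ₀∈H → case trans (sym (proj₁ par)) (H⊆ker ψ par ρ₀∈H) of λ ()) , H-cosets

  index-2⇒even-relators : HasIndex2 Γ H → EvenRelators Γ ρ
  index-2⇒even-relators (g , g∉H , _) w w≋id with odd (count0 w) in parity
  ... | false = even⇒2∣ _ parity
  ... | true  = ⊥-elim (g∉H (ρ₀∈H⇒H-total ρ₀∈H g))
    where
    ρ₀∈H : H (ρ zero)
    ρ₀∈H = resp (λ x → cong (ρ zero ⊳_) (w≋id x)) (proj₂ (parity-coset w) parity)

proposition4p3 : ∀ {m : ℕ} (Γ : IncidenceSystem (suc (suc m)))
    → IsRegularHypertope Γ → B1 Γ → B2 Γ
    → (C : Chamber Γ) (ρ : Fin (suc (suc m)) → Aut Γ)
    → (∀ i → IsStdGen Γ C i (ρ i))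
    → (Bipartite𝒢 Γ ⇔ HasIndex2 Γ (HalvingGroup Γ ρ))
    × (Bipartite𝒢 Γ ⇔ (∀ (w : List (Fin (suc (suc m)))) → IsRelator Γ ρ w → 2 ∣ count0 w))
    × (Bipartite𝒢 Γ ⇔ Σ (HomToZ2 Γ) λ ψ →
         (HomToZ2.φ ψ (ρ zero) ≡ true) ×
         (∀ i → i ≢ zero → HomToZ2.φ ψ (ρ i) ≡ false))
proposition4p3 Γ hyp b1 b2 C ρ std =
    mk⇔ (parity-hom⇒index-2 ∘ bipartite⇒parity-hom)
        (parity-hom⇒bipartite b1 ∘ even-relators⇒parity-hom ∘ index-2⇒even-relators)
  , mk⇔ (parity-hom⇒even-relators Γ ρ ∘ bipartite⇒parity-hom)
        (parity-hom⇒bipartite b1 ∘ even-relators⇒parity-hom)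
  , mk⇔ bipartite⇒parity-hom (parity-hom⇒bipartite b1)
  where
  open IsRegularHypertope hyp
  open RelatorParity Γ geometry thin resConn C ρ std
  open Bipartition Γ geometry thin resConn C ρ std
  open Halving Γ geometry thin resConn b1 b2 C ρ std
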